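{- Let $C$ be an $[n,k,d]_qR$ code that is uniformly packed in the wide sense. Then all cosets of $C$ of weight $R$ have the same weight distribution, and $C$ is an $(R,\mathcal{A}_R)$-APMCF code, where $\mathcal{A}_R$ is the number of vectors of Hamming weight $R$ in any coset of $C$ of weight $R$. If moreover $d\ge2R$, then $C$ is an $(R,\mathcal{A}_R)$-PMCF code.
   Context: An $[n,k,d]_qR$ code is a $k$-dimensional linear subspace $C$ of $\mathbb{F}_q^n$ with minimum distance $d$ and covering radius $R$. A coset of $C$ is $C+u$, $u\in\mathbb{F}_q^n$; its weight is the minimum Hamming weight of its vectors, and its weight distribution is the list of numbers of its vectors of each weight. $B_j(v,C)$ is the number of codewords at Hamming distance $j$ from $v$. $C$ is uniformly packed in the wide sense (UPWS) if there exist rationals $\beta_0,\dots,\beta_R$ with $\sum_{j=0}^R\beta_jB_j(v,C)=1$ for all $v\in\mathbb{F}_q^n$. $C$ is an $(R,\lambda)$-APMCF code if $B_R(v,C)=\lambda$ for all $v$ with $d(v,C)=R$; it is $(R,\lambda)$-PMCF if in addition $d\ge2R$. -}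

module Defs where

open import Data.Nat as ℕ using (ℕ; zero; suc; _≤_)
open import Data.Fin using (Fin)
open import Data.List using (List; []; _∷_; map; concatMap; length; filter; allFin)
import Data.Vec.Functional as VF
open import Data.Product using (Σ; ∃; _×_; _,_)
open import Data.Integer using (+_)
open import Data.Rational using (ℚ; 1ℚ; 0ℚ)
import Data.Rational as ℚ
open import Relation.Nullary using (¬_; Dec; yes; no)
open import Relation.Binary.PropositionalEquality using (_≡_; _≢_)
open import Algebra.Structures using (IsCommutativeRing)
open import Function.Bundles using (_↔_; Inverse)

record FiniteField (q : ℕ) : Set₁ where
  field
    Carrier : Set
    _+_ _*_ : Carrier → Carrier → Carrier
    -_      : Carrier → Carrier
    0# 1#   : Carrier
    isCommutativeRing : IsCommutativeRing _≡_ _+_ _*_ -_ 0# 1#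
    0≢1     : 0# ≢ 1#
    inverse : ∀ x → x ≢ 0# → ∃ λ y → x * y ≡ 1#
    _≟_     : (x y : Carrier) → Dec (x ≡ y)
    enum    : Carrier ↔ Fin q

module Code {q : ℕ} (F : FiniteField q) where
  open FiniteField F

  Word : ℕ → Set
  Word n = Fin n → Carrier

  elements : List Carrier
  elements = map (Inverse.from enum) (allFin q)

  allWords : (n : ℕ) → List (Word n)
  allWords zero    = (λ ()) ∷ []
  allWords (suc n) =
    concatMap (λ a → map (λ w → a VF.∷ w) (allWords n)) elements

  countWords : (n : ℕ) → (Word n → ℕ) → (Word n → ℕ) → ℕ
  countWords n f g = length (filter (λ w → f w ℕ.≟ g w) (allWords n))

  #[_∣_≡_] : (n : ℕ) → (Word n → ℕ) → ℕ → ℕ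
  #[ n ∣ f ≡ j ] = countWords n f (λ _ → j)

  indicator≢ : Carrier → Carrier → ℕ
  indicator≢ a b with a ≟ b
  ... | yes _ = 0
  ... | no  _ = 1

  dist : {n : ℕ} → Word n → Word n → ℕ
  dist x y = VF.foldr ℕ._+_ 0 (λ i → indicator≢ (x i) (y i))

  wt : {n : ℕ} → Word n → ℕ
  wt x = dist x (λ _ → 0#)

  _⊕_ : {n : ℕ} → Word n → Word n → Word n
  (x ⊕ y) i = x i + y i

  IsZero : {n : ℕ} → Word n → Set
  IsZero x = ∀ i → x i ≡ 0#

  -- A k-dimensional subspace C of F_q^n is presented by a generator
  -- matrix G (k linearly independent rows spanning C):
  --   C = { m G | m ∈ F_q^k },  m ↦ m G injective.

  sumF : {k : ℕ} → (Fin k → Carrier) → Carrier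
  sumF = VF.foldr _+_ 0#

  encode : {k n : ℕ} → (Fin k → Word n) → Word k → Word n
  encode G m j = sumF (λ i → m i * G i j)

  LinearlyIndependent : {k n : ℕ} → (Fin k → Word n) → Set
  LinearlyIndependent G = ∀ m → IsZero (encode G m) → IsZero m

  _∈C[_] : {k n : ℕ} → Word n → (Fin k → Word n) → Set
  c ∈C[ G ] = ∃ λ m → ∀ j → c j ≡ encode G m j

  DistToCode : {k n : ℕ} → (Fin k → Word n) → Word n → ℕ → Set
  DistToCode G v r =
    (∃ λ c → c ∈C[ G ] × dist v c ≡ r) × (∀ c → c ∈C[ G ] → r ≤ dist v c)

  CosetWeight : {k n : ℕ} → (Fin k → Word n) → Word n → ℕ → Set
  CosetWeight G u w =
    (∃ λ c → c ∈C[ G ] × wt (u ⊕ c) ≡ w) × (∀ c → c ∈C[ G ] → w ≤ wt (u ⊕ c))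

  record IsCode (n k d R : ℕ) (G : Fin k → Word n) : Set where
    field
      independent : LinearlyIndependent G
      minDist-attained : ∃ λ c → c ∈C[ G ] × ¬ IsZero c × wt c ≡ d
      minDist-bound    : ∀ c → c ∈C[ G ] → ¬ IsZero c → d ≤ wt c
      covers           : ∀ (v : Word n) → ∃ λ c → c ∈C[ G ] × dist v c ≤ R
      radius-attained  : ∃ λ (v : Word n) → DistToCode G v R

  -- B_j(v, C): number of codewords at distance j from v
  -- (codewords counted via their unique message m, c = m G)
  B : {k n : ℕ} → (Fin k → Word n) → ℕ → Word n → ℕ
  B {k} G j v = #[ k ∣ (λ m → dist v (encode G m)) ≡ j ]

  cosetWD : {k n : ℕ} → (Fin k → Word n) → Word n → ℕ → ℕ
  cosetWD {k} G u i = #[ k ∣ (λ m → wt (u ⊕ encode G m)) ≡ i ]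

  toℚ : ℕ → ℚ
  toℚ n = + n ℚ./ 1

  UPWS : {k n : ℕ} → (Fin k → Word n) → ℕ → Set
  UPWS {k} {n} G R =
    ∃ λ (β : Fin (suc R) → ℚ) →
      ∀ (v : Word n) →
        VF.foldr ℚ._+_ 0ℚ (λ j → β j ℚ.* toℚ (B G (Data.Fin.toℕ j) v)) ≡ 1ℚ

  APMCF : {k n : ℕ} → (Fin k → Word n) → ℕ → ℕ → Set
  APMCF {k} {n} G R λ′ = ∀ (v : Word n) → DistToCode G v R → B G R v ≡ λ′

  PMCF : {k n : ℕ} → (Fin k → Word n) → ℕ → ℕ → ℕ → Set
  PMCF G d R λ′ = (2 ℕ.* R ≤ d) × APMCF G R λ′

module Submission where

-- For a word v and coefficients γ, ∑_{c ∈ C} γ(d(v,c)) = ∑_j γ_j B_j(v).  Summing such an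
-- expression over the n(q-1) Hamming neighbours of v gives one of the same shape whose
-- coefficients T γ have degree one higher, with leading coefficient (L+1)γ_L.  Uniform packing
-- is a relation ∑_{j ≤ R} β_j B_j(v) = 1 valid for every v, and β_R ≠ 0 because at a word at
-- distance R from C only the term β_R B_R survives.  Iterating T yields, for every t, a relation
-- of degree R + t with nonzero leading coefficient, constant in v.  For words at distance R from C,
-- where B_j = 0 for j < R, these relations determine B_R, B_{R+1}, … one after another, so
-- B_•(v) does not depend on v.  Finally the coset u + C has weight distribution B_•(u), since
-- wt(u + c) = d(u, -c).

open import Defs
open import Data.Nat using (ℕ; _≤_; _*_)
open import Data.Fin using (Fin)
open import Data.Product using (_×_)
open import Relation.Binary.PropositionalEquality using (_≡_)

open import Algebra.Bundles using (CommutativeRing)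
import Algebra.Properties.CommutativeMonoid.Sum as CommutativeMonoidSum
import Algebra.Properties.Group as GroupProperties
import Algebra.Properties.Ring as RingProperties
open import Data.Bool using (if_then_else_)
open import Data.Empty using (⊥-elim)
open import Data.Fin using (zero; suc; toℕ)
import Data.Fin.Properties as Finₚ
open import Data.Fin.Permutation using (Permutation; permutation)
import Data.Integer as ℤ
import Data.Integer.Properties as ℤₚ
open import Data.List using (List; []; _∷_; _++_; map; concatMap; filter; length; allFin; tabulate)
import Data.List.Properties as Listₚ
open import Data.Nat using (zero; suc; _<_; s≤s)
import Data.Nat as ℕ
open import Data.Nat.Coprimality using (1-coprimeTo) renaming (sym to coprime-sym)
import Data.Nat.Properties as ℕₚ
open import Data.Product using (∃; _,_)
open import Data.Rational as ℚ using (ℚ; 0ℚ; 1ℚ; mkℚ; _+_; _-_) renaming (_*_ to _·_)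
import Data.Rational.Properties as ℚₚ
open import Data.Rational.Solver using (module +-*-Solver)
open import Data.Sum using (inj₁; inj₂)
import Data.Vec.Functional as Vector
open import Function.Base using (_∘_; const)
open import Function.Bundles using (Inverse)
open import Level using (0ℓ)
open import Relation.Nullary using (Dec; does; yes; no)
open import Relation.Binary.PropositionalEquality
  using (_≢_; refl; sym; trans; cong; cong₂; subst; module ≡-Reasoning)

open +-*-Solver

-- Agrees definitionally with Code.toℚ, which is only in scope under a field.
toℚ : ℕ → ℚ
toℚ n = ℤ.+ n ℚ./ 1

private
  toℚ-mkℚ : ∀ n → toℚ n ≡ mkℚ (ℤ.+ n) 0 (coprime-sym (1-coprimeTo n))
  toℚ-mkℚ n = ℚₚ.normalize-coprime (coprime-sym (1-coprimeTo n))

toℚ-+ : ∀ a b → toℚ (a ℕ.+ b) ≡ toℚ a + toℚ b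
toℚ-+ a b = sym (begin
  toℚ a + toℚ b
    ≡⟨ cong₂ _+_ (toℚ-mkℚ a) (toℚ-mkℚ b) ⟩
  (ℤ.+ a ℤ.* ℤ.+ 1 ℤ.+ ℤ.+ b ℤ.* ℤ.+ 1) ℚ./ 1
    ≡⟨ cong (ℚ._/ 1) (cong₂ ℤ._+_ (ℤₚ.*-identityʳ (ℤ.+ a)) (ℤₚ.*-identityʳ (ℤ.+ b))) ⟩
  toℚ (a ℕ.+ b) ∎)
  where open ≡-Reasoning

toℚ-injective : ∀ {a b} → toℚ a ≡ toℚ b → a ≡ b
toℚ-injective {a} {b} eq =
  ℤₚ.+-injective (cong ℚ.numerator (trans (sym (toℚ-mkℚ a)) (trans eq (toℚ-mkℚ b))))

toℚ-suc≢0 : ∀ a → toℚ (suc a) ≢ 0ℚ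
toℚ-suc≢0 a eq = ℕₚ.1+n≢0 (toℚ-injective {suc a} {0} eq)

*-cancelˡ-≢0 : ∀ a {x y} → a ≢ 0ℚ → a · x ≡ a · y → x ≡ y
*-cancelˡ-≢0 a {x} {y} a≢0 eq = begin
  x               ≡⟨ sym (ℚₚ.*-identityˡ x) ⟩
  1ℚ · x          ≡⟨ cong (_· x) (sym a⁻¹a≡1) ⟩
  a⁻¹ · a · x     ≡⟨ ℚₚ.*-assoc a⁻¹ a x ⟩
  a⁻¹ · (a · x)   ≡⟨ cong (a⁻¹ ·_) eq ⟩
  a⁻¹ · (a · y)   ≡⟨ sym (ℚₚ.*-assoc a⁻¹ a y) ⟩
  a⁻¹ · a · y     ≡⟨ cong (_· y) a⁻¹a≡1 ⟩
  1ℚ · y          ≡⟨ ℚₚ.*-identityˡ y ⟩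
  y               ∎
  where
  open ≡-Reasoning
  instance
    a-nonZero : ℚ.NonZero a
    a-nonZero = ℚ.≢-nonZero a≢0
  a⁻¹ : ℚ
  a⁻¹ = ℚ.1/ a
  a⁻¹a≡1 : a⁻¹ · a ≡ 1ℚ
  a⁻¹a≡1 = ℚₚ.*-inverseˡ a

*-≢0 : ∀ {a b} → a ≢ 0ℚ → b ≢ 0ℚ → a · b ≢ 0ℚ
*-≢0 {a} {b} a≢0 b≢0 ab≡0 = b≢0 (*-cancelˡ-≢0 a a≢0 (trans ab≡0 (sym (ℚₚ.*-zeroʳ a))))

+-cancelˡ : ∀ a {x y} → a + x ≡ a + y → x ≡ y
+-cancelˡ a = GroupProperties.∙-cancelˡ ℚₚ.+-0-group a _ _

-- Finite sums

open CommutativeMonoidSum ℚₚ.+-0-commutativeMonoid using (sum; sum-cong-≗; ∑-permute)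
module ℕSum = CommutativeMonoidSum ℕₚ.+-0-commutativeMonoid

sum-const : ∀ n c → sum {n} (const c) ≡ toℚ n · c
sum-const zero    c = sym (ℚₚ.*-zeroˡ c)
sum-const (suc n) c = begin
  c + sum {n} (const c)  ≡⟨ cong (c +_) (sum-const n c) ⟩
  c + toℚ n · c          ≡⟨ solve 2 (λ c t → c :+ t :* c := (con 1ℚ :+ t) :* c) refl c (toℚ n) ⟩
  (1ℚ + toℚ n) · c       ≡⟨ cong (_· c) (sym (toℚ-+ 1 n)) ⟩
  toℚ (suc n) · c        ∎
  where open ≡-Reasoning

sum-single : ∀ {n} (f : Fin n → ℚ) i → (∀ j → j ≢ i → f j ≡ 0ℚ) → sum f ≡ f i
sum-single {suc n} f zero    f≡0 = begin
  f zero + sum (λ j → f (suc j))  ≡⟨ cong (f zero +_) (sum-cong-≗ (λ j → f≡0 (suc j) λ ())) ⟩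
  f zero + sum {n} (const 0ℚ)     ≡⟨ cong (f zero +_) (trans (sum-const n 0ℚ) (ℚₚ.*-zeroʳ (toℚ n))) ⟩
  f zero + 0ℚ                     ≡⟨ ℚₚ.+-identityʳ (f zero) ⟩
  f zero                          ∎
  where open ≡-Reasoning
sum-single {suc n} f (suc i) f≡0 = begin
  f zero + sum (λ j → f (suc j))  ≡⟨ cong₂ _+_ (f≡0 zero λ ()) (sum-single (λ j → f (suc j)) i f∘suc≡0) ⟩
  0ℚ + f (suc i)                  ≡⟨ ℚₚ.+-identityˡ (f (suc i)) ⟩
  f (suc i)                       ∎
  where
  open ≡-Reasoning
  f∘suc≡0 : ∀ j → j ≢ i → f (suc j) ≡ 0ℚ
  f∘suc≡0 j j≢i = f≡0 (suc j) (λ eq → j≢i (Finₚ.suc-injective eq))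

sum-affine : ∀ {n} (f : Fin n → ℕ) (x y : ℚ) →
  sum (λ i → toℚ (f i) · x + (1ℚ - toℚ (f i)) · y)
    ≡ toℚ (ℕSum.sum f) · x + (toℚ n - toℚ (ℕSum.sum f)) · y
sum-affine {zero}  f x y = solve 2 (λ x y → con 0ℚ := con 0ℚ :* x :+ (con 0ℚ :- con 0ℚ) :* y) refl x y
sum-affine {suc n} f x y = begin
  a · x + (1ℚ - a) · y + sum (λ i → toℚ (f (suc i)) · x + (1ℚ - toℚ (f (suc i))) · y)
    ≡⟨ cong (a · x + (1ℚ - a) · y +_) (sum-affine (λ i → f (suc i)) x y) ⟩
  a · x + (1ℚ - a) · y + (s · x + (toℚ n - s) · y)
    ≡⟨ solve 5 (λ a s t x y → a :* x :+ (con 1ℚ :- a) :* y :+ (s :* x :+ (t :- s) :* y)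
                            := (a :+ s) :* x :+ ((con 1ℚ :+ t) :- (a :+ s)) :* y)
         refl a s (toℚ n) x y ⟩
  (a + s) · x + ((1ℚ + toℚ n) - (a + s)) · y
    ≡⟨ sym (cong₂ (λ u v → u · x + (v - u) · y) (toℚ-+ (f zero) _) (toℚ-+ 1 n)) ⟩
  toℚ (f zero ℕ.+ ℕSum.sum (λ i → f (suc i))) · x
    + (toℚ (suc n) - toℚ (f zero ℕ.+ ℕSum.sum (λ i → f (suc i)))) · y ∎
  where
  open ≡-Reasoning
  a s : ℚ
  a = toℚ (f zero)
  s = toℚ (ℕSum.sum (λ i → f (suc i)))

∑∈ : {A : Set} → List A → (A → ℚ) → ℚ
∑∈ []       f = 0ℚ
∑∈ (x ∷ xs) f = f x + ∑∈ xs f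

syntax ∑∈ xs (λ x → e) = ∑[ x ∈ xs ] e

module _ {A : Set} where

  ∑∈-cong : (xs : List A) {f g : A → ℚ} → (∀ x → f x ≡ g x) → ∑∈ xs f ≡ ∑∈ xs g
  ∑∈-cong []       f≗g = refl
  ∑∈-cong (x ∷ xs) f≗g = cong₂ _+_ (f≗g x) (∑∈-cong xs f≗g)

  ∑∈-zero : (xs : List A) → ∑[ x ∈ xs ] 0ℚ ≡ 0ℚ
  ∑∈-zero []       = refl
  ∑∈-zero (x ∷ xs) = trans (ℚₚ.+-identityˡ _) (∑∈-zero xs)

  ∑∈-distrib-+ : (xs : List A) (f g : A → ℚ) →
    ∑[ x ∈ xs ] (f x + g x) ≡ ∑∈ xs f + ∑∈ xs g
  ∑∈-distrib-+ []       f g = sym (ℚₚ.+-identityˡ 0ℚ)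
  ∑∈-distrib-+ (x ∷ xs) f g = begin
    f x + g x + ∑[ x ∈ xs ] (f x + g x)  ≡⟨ cong (f x + g x +_) (∑∈-distrib-+ xs f g) ⟩
    f x + g x + (∑∈ xs f + ∑∈ xs g)      ≡⟨ solve 4 (λ a b c d → (a :+ b) :+ (c :+ d) := (a :+ c) :+ (b :+ d))
                                               refl (f x) (g x) (∑∈ xs f) (∑∈ xs g) ⟩
    f x + ∑∈ xs f + (g x + ∑∈ xs g)      ∎
    where open ≡-Reasoning

  ∑∈-++ : (xs ys : List A) (f : A → ℚ) → ∑∈ (xs ++ ys) f ≡ ∑∈ xs f + ∑∈ ys f
  ∑∈-++ []       ys f = sym (ℚₚ.+-identityˡ _)
  ∑∈-++ (x ∷ xs) ys f = trans (cong (f x +_) (∑∈-++ xs ys f)) (sym (ℚₚ.+-assoc (f x) _ _))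

  ∑∈-tabulate : ∀ {n} (g : Fin n → A) (f : A → ℚ) → ∑∈ (tabulate g) f ≡ sum (λ i → f (g i))
  ∑∈-tabulate {zero}  g f = refl
  ∑∈-tabulate {suc n} g f = cong (f (g zero) +_) (∑∈-tabulate (λ i → g (suc i)) f)

  sum-∑∈-comm : ∀ {n} (xs : List A) (f : Fin n → A → ℚ) →
    sum (λ i → ∑∈ xs (f i)) ≡ ∑[ x ∈ xs ] sum (λ i → f i x)
  sum-∑∈-comm {zero}  xs f = sym (∑∈-zero xs)
  sum-∑∈-comm {suc n} xs f = trans (cong (∑∈ xs (f zero) +_) (sum-∑∈-comm xs (λ i → f (suc i))))
                                   (sym (∑∈-distrib-+ xs (f zero) _))

module _ {A B : Set} where

  ∑∈-map : (g : A → B) (xs : List A) (f : B → ℚ) → ∑∈ (map g xs) f ≡ ∑[ x ∈ xs ] f (g x)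
  ∑∈-map g []       f = refl
  ∑∈-map g (x ∷ xs) f = cong (f (g x) +_) (∑∈-map g xs f)

  ∑∈-concatMap : (g : A → List B) (xs : List A) (f : B → ℚ) →
    ∑∈ (concatMap g xs) f ≡ ∑[ x ∈ xs ] ∑∈ (g x) f
  ∑∈-concatMap g []       f = refl
  ∑∈-concatMap g (x ∷ xs) f =
    trans (∑∈-++ (g x) (concatMap g xs) f) (cong (∑∈ (g x) f +_) (∑∈-concatMap g xs f))

  ∑∈-comm : (xs : List A) (ys : List B) (f : A → B → ℚ) →
    ∑[ x ∈ xs ] ∑∈ ys (f x) ≡ ∑[ y ∈ ys ] ∑[ x ∈ xs ] f x y
  ∑∈-comm []       ys f = sym (∑∈-zero ys)
  ∑∈-comm (x ∷ xs) ys f = trans (cong (∑∈ ys (f x) +_) (∑∈-comm xs ys f))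
                                (sym (∑∈-distrib-+ ys (f x) _))

∑< : ℕ → (ℕ → ℚ) → ℚ
∑< zero    h = 0ℚ
∑< (suc m) h = ∑< m h + h m

syntax ∑< m (λ j → e) = ∑[ j < m ] e

∑<-cong : ∀ m {g h : ℕ → ℚ} → (∀ j → j < m → g j ≡ h j) → ∑< m g ≡ ∑< m h
∑<-cong zero    g≡h = refl
∑<-cong (suc m) g≡h = cong₂ _+_ (∑<-cong m (λ j j<m → g≡h j (ℕₚ.m<n⇒m<1+n j<m))) (g≡h m ℕₚ.≤-refl)

∑<-distrib-+ : ∀ m {g h : ℕ → ℚ} → ∑[ j < m ] (g j + h j) ≡ ∑< m g + ∑< m h
∑<-distrib-+ zero    = sym (ℚₚ.+-identityˡ 0ℚ)
∑<-distrib-+ (suc m) {g} {h} = trans (cong (_+ (g m + h m)) (∑<-distrib-+ m))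
  (solve 4 (λ a b c d → (a :+ b) :+ (c :+ d) := (a :+ c) :+ (b :+ d)) refl (∑< m g) (∑< m h) (g m) (h m))

∑<-zero : ∀ m (h : ℕ → ℚ) → (∀ j → j < m → h j ≡ 0ℚ) → ∑< m h ≡ 0ℚ
∑<-zero m h h≡0 = trans (∑<-cong m h≡0) (∑<-const0 m)
  where
  ∑<-const0 : ∀ m → ∑[ j < m ] 0ℚ ≡ 0ℚ
  ∑<-const0 zero    = refl
  ∑<-const0 (suc m) = trans (ℚₚ.+-identityʳ _) (∑<-const0 m)

∑<-single : ∀ m (h : ℕ → ℚ) y → y < m → (∀ j → j ≢ y → h j ≡ 0ℚ) → ∑< m h ≡ h y
∑<-single (suc m) h y y<1+m h≡0 with y ℕ.≟ m
... | yes refl = trans (cong (_+ h y) (∑<-zero m h (λ j j<y → h≡0 j (ℕₚ.<⇒≢ j<y)))) (ℚₚ.+-identityˡ _)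
... | no y≢m   = trans (cong₂ _+_ (∑<-single m h y (ℕₚ.≤∧≢⇒< (ℕₚ.≤-pred y<1+m) y≢m) h≡0)
                                  (h≡0 m (λ m≡y → y≢m (sym m≡y))))
                       (ℚₚ.+-identityʳ _)

∑<-suc : ∀ m (h : ℕ → ℚ) → ∑< (suc m) h ≡ h 0 + ∑[ j < m ] h (suc j)
∑<-suc zero    h = trans (ℚₚ.+-identityˡ (h 0)) (sym (ℚₚ.+-identityʳ (h 0)))
∑<-suc (suc m) h = trans (cong (_+ h (suc m)) (∑<-suc m h)) (ℚₚ.+-assoc (h 0) _ _)

zeroExtend : ∀ {L} → (Fin L → ℚ) → ℕ → ℚ
zeroExtend {zero}  β j       = 0ℚ
zeroExtend {suc L} β zero    = β zero
zeroExtend {suc L} β (suc j) = zeroExtend (λ i → β (suc i)) j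

zeroExtend-vanishes : ∀ {L} (β : Fin L → ℚ) j → L ≤ j → zeroExtend β j ≡ 0ℚ
zeroExtend-vanishes {zero}  β j       L≤j       = refl
zeroExtend-vanishes {suc L} β (suc j) (s≤s L≤j) = zeroExtend-vanishes (λ i → β (suc i)) j L≤j

sum≡∑<-zeroExtend : ∀ L (β : Fin L → ℚ) (g : ℕ → ℚ) →
  sum (λ j → β j · g (toℕ j)) ≡ ∑[ j < L ] (zeroExtend β j · g j)
sum≡∑<-zeroExtend zero    β g = refl
sum≡∑<-zeroExtend (suc L) β g =
  trans (cong (β zero · g 0 +_) (sum≡∑<-zeroExtend L (λ i → β (suc i)) (λ j → g (suc j))))
        (sym (∑<-suc L (λ j → zeroExtend β j · g j)))

-- Counting

count : {A : Set} → List A → (A → ℕ) → ℕ → ℕ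
count xs f j = length (filter (λ x → f x ℕ.≟ j) xs)

δ : ℕ → ℕ → ℚ
δ a b with a ℕ.≟ b
... | yes _ = 1ℚ
... | no  _ = 0ℚ

δ-refl : ∀ a → δ a a ≡ 1ℚ
δ-refl a with a ℕ.≟ a
... | yes _   = refl
... | no  a≢a = ⊥-elim (a≢a refl)

δ-≢ : ∀ {a b} → a ≢ b → δ a b ≡ 0ℚ
δ-≢ {a} {b} a≢b with a ℕ.≟ b
... | yes a≡b = ⊥-elim (a≢b a≡b)
... | no  _   = refl

toℚ-count-∷ : {A : Set} (x : A) (xs : List A) (f : A → ℕ) (j : ℕ) →
  toℚ (count (x ∷ xs) f j) ≡ δ (f x) j + toℚ (count xs f j)
toℚ-count-∷ x xs f j with f x ℕ.≟ j
... | yes fx≡j = trans (cong (toℚ ∘ length) (Listₚ.filter-accept (λ x → f x ℕ.≟ j) fx≡j)) (toℚ-+ 1 (count xs f j))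
... | no  fx≢j = trans (cong (toℚ ∘ length) (Listₚ.filter-reject (λ x → f x ℕ.≟ j) fx≢j)) (sym (ℚₚ.+-identityˡ _))

toℚ-count : {A : Set} (xs : List A) (f : A → ℕ) (j : ℕ) → toℚ (count xs f j) ≡ ∑[ x ∈ xs ] δ (f x) j
toℚ-count []       f j = refl
toℚ-count (x ∷ xs) f j = trans (toℚ-count-∷ x xs f j) (cong (δ (f x) j +_) (toℚ-count xs f j))

count-≡0 : {A : Set} (xs : List A) (f : A → ℕ) (j : ℕ) → (∀ x → f x ≢ j) → count xs f j ≡ 0
count-≡0 xs f j f≢j = toℚ-injective (begin
  toℚ (count xs f j)       ≡⟨ toℚ-count xs f j ⟩
  ∑[ x ∈ xs ] δ (f x) j    ≡⟨ ∑∈-cong xs (λ x → δ-≢ (f≢j x)) ⟩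
  ∑[ x ∈ xs ] 0ℚ           ≡⟨ ∑∈-zero xs ⟩
  0ℚ                       ∎)
  where open ≡-Reasoning

∑<-δ : ∀ m (γ : ℕ → ℚ) → (∀ j → m ≤ j → γ j ≡ 0ℚ) → ∀ y → ∑[ j < m ] (γ j · δ y j) ≡ γ y
∑<-δ m γ γ≡0 y with y ℕ.<? m
... | yes y<m = trans (∑<-single m _ y y<m off-y) (trans (cong (γ y ·_) (δ-refl y)) (ℚₚ.*-identityʳ (γ y)))
  where
  off-y : ∀ j → j ≢ y → γ j · δ y j ≡ 0ℚ
  off-y j j≢y = trans (cong (γ j ·_) (δ-≢ {y} {j} (j≢y ∘ sym))) (ℚₚ.*-zeroʳ (γ j))
... | no  y≮m = trans (∑<-zero m _ vanish) (sym (γ≡0 y (ℕₚ.≮⇒≥ y≮m)))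
  where
  vanish : ∀ j → j < m → γ j · δ y j ≡ 0ℚ
  vanish j j<m = trans (cong (γ j ·_) (δ-≢ {y} {j} λ { refl → y≮m j<m })) (ℚₚ.*-zeroʳ (γ j))

∑∈-regroup : ∀ m (γ : ℕ → ℚ) → (∀ j → m ≤ j → γ j ≡ 0ℚ) → {A : Set} (xs : List A) (f : A → ℕ) →
  ∑[ x ∈ xs ] γ (f x) ≡ ∑[ j < m ] (γ j · toℚ (count xs f j))
∑∈-regroup m γ γ≡0 [] f = sym (∑<-zero m _ (λ j _ → ℚₚ.*-zeroʳ (γ j)))
∑∈-regroup m γ γ≡0 (x ∷ xs) f = begin
  γ (f x) + ∑[ x ∈ xs ] γ (f x)
    ≡⟨ cong₂ _+_ (sym (∑<-δ m γ γ≡0 (f x))) (∑∈-regroup m γ γ≡0 xs f) ⟩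
  ∑[ j < m ] (γ j · δ (f x) j) + ∑[ j < m ] (γ j · toℚ (count xs f j))
    ≡⟨ sym (∑<-distrib-+ m) ⟩
  ∑[ j < m ] (γ j · δ (f x) j + γ j · toℚ (count xs f j))
    ≡⟨ ∑<-cong m (λ j _ → trans (sym (ℚₚ.*-distribˡ-+ (γ j) _ _)) (cong (γ j ·_) (sym (toℚ-count-∷ x xs f j)))) ⟩
  ∑[ j < m ] (γ j · toℚ (count (x ∷ xs) f j)) ∎
  where
  open ≡-Reasoning

-- Words over a finite field

module CodeProperties {q : ℕ} (F : FiniteField q) where

  open FiniteField F renaming (_+_ to infixl 6 _+F_; _*_ to infixl 7 _*F_; -_ to infix 8 -F_)
  open Code F hiding (toℚ)

  private
    commutativeRing : CommutativeRing 0ℓ 0ℓ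
    commutativeRing = record { isCommutativeRing = isCommutativeRing }

  open CommutativeRing commutativeRing using (-‿inverseˡ; +-commutativeMonoid)
  open RingProperties (CommutativeRing.ring commutativeRing)
    using (-‿involutive; +-inverseˡ-unique; -‿distribˡ-*; -‿+-comm; -0#≈0#)
  private
    module FSum = CommutativeMonoidSum +-commutativeMonoid

  q̂ : ℚ
  q̂ = toℚ q

  negate : ∀ {n} → Word n → Word n
  negate x i = -F (x i)

  indicator≢-≡ : ∀ {a b} → a ≡ b → indicator≢ a b ≡ 0
  indicator≢-≡ {a} {b} a≡b with a ≟ b
  ... | yes _   = refl
  ... | no  a≢b = ⊥-elim (a≢b a≡b)

  indicator≢-≢ : ∀ {a b} → a ≢ b → indicator≢ a b ≡ 1
  indicator≢-≢ {a} {b} a≢b with a ≟ b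
  ... | yes a≡b = ⊥-elim (a≢b a≡b)
  ... | no  _   = refl

  indicator≢-+ : ∀ a b → indicator≢ (a +F b) 0# ≡ indicator≢ a (-F b)
  indicator≢-+ a b with a ≟ (-F b) | (a +F b) ≟ 0#
  ... | yes _    | yes _     = refl
  ... | no  _    | no  _     = refl
  ... | yes refl | no a+b≢0  = ⊥-elim (a+b≢0 (-‿inverseˡ b))
  ... | no a≢-b  | yes a+b≡0 = ⊥-elim (a≢-b (+-inverseˡ-unique a b a+b≡0))

  dist-cong : ∀ {n} {x x′ y y′ : Word n} → (∀ i → x i ≡ x′ i) → (∀ i → y i ≡ y′ i) →
    dist x y ≡ dist x′ y′
  dist-cong x≗x′ y≗y′ = ℕSum.sum-cong-≗ (λ i → cong₂ indicator≢ (x≗x′ i) (y≗y′ i))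

  wt-⊕ : ∀ {n} (u c : Word n) → wt (u ⊕ c) ≡ dist u (negate c)
  wt-⊕ u c = ℕSum.sum-cong-≗ (λ i → indicator≢-+ (u i) (c i))

  encode-cong : ∀ {k n} (G : Fin k → Word n) {m m′ : Word k} → (∀ i → m i ≡ m′ i) →
    ∀ j → encode G m j ≡ encode G m′ j
  encode-cong G m≗m′ j = FSum.sum-cong-≗ (λ i → cong (_*F G i j) (m≗m′ i))

  encode-negate : ∀ {k n} (G : Fin k → Word n) (m : Word k) j →
    encode G (negate m) j ≡ -F (encode G m j)
  encode-negate G m j =
    trans (FSum.sum-cong-≗ (λ i → sym (-‿distribˡ-* (m i) (G i j)))) (sumF-negate (λ i → m i *F G i j))
    where
    sumF-negate : ∀ {k} (f : Fin k → Carrier) → sumF (λ i → -F (f i)) ≡ -F (sumF f)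
    sumF-negate {zero}  f = sym -0#≈0#
    sumF-negate {suc k} f = trans (cong (-F (f zero) +F_) (sumF-negate (λ i → f (suc i))))
                                  (-‿+-comm (f zero) (sumF (λ i → f (suc i))))

  negate-∈C : ∀ {k n} {G : Fin k → Word n} {c : Word n} → c ∈C[ G ] → negate c ∈C[ G ]
  negate-∈C {G = G} (m , c≡mG) = negate m , λ j → trans (cong -F_ (c≡mG j)) (sym (encode-negate G m j))

  private
    from : Fin q → Carrier
    from = Inverse.from enum

    to : Carrier → Fin q
    to = Inverse.to enum

  ∑-elements≡sum : ∀ (h : Carrier → ℚ) → ∑[ a ∈ elements ] h a ≡ sum (λ i → h (from i))
  ∑-elements≡sum h = trans (∑∈-map from (allFin q) h) (∑∈-tabulate (λ i → i) (λ i → h (from i)))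

  ∑-elements-single : ∀ (h : Carrier → ℚ) a → (∀ b → b ≢ a → h b ≡ 0ℚ) → ∑[ b ∈ elements ] h b ≡ h a
  ∑-elements-single h a h≡0 =
    trans (∑-elements≡sum h) (trans (sum-single (λ i → h (from i)) (to a) off-a)
                                    (cong h (Inverse.strictlyInverseʳ enum a)))
    where
    off-a : ∀ i → i ≢ to a → h (from i) ≡ 0ℚ
    off-a i i≢a = h≡0 (from i) (λ i≡a → i≢a (trans (sym (Inverse.strictlyInverseˡ enum i)) (cong to i≡a)))

  ∑-elements-const : ∀ c → ∑[ b ∈ elements ] c ≡ q̂ · c
  ∑-elements-const c = trans (∑-elements≡sum (const c)) (sum-const q c)

  ∑-elements-involution : ∀ (σ : Carrier → Carrier) → (∀ a → σ (σ a) ≡ a) →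
    ∀ (h : Carrier → ℚ) → ∑[ a ∈ elements ] h (σ a) ≡ ∑[ a ∈ elements ] h a
  ∑-elements-involution σ σσ≡id h = begin
    ∑[ a ∈ elements ] h (σ a)           ≡⟨ ∑-elements≡sum (h ∘ σ) ⟩
    sum (λ i → h (σ (from i)))          ≡⟨ ∑-permute (λ i → h (σ (from i))) π ⟩
    sum (λ i → h (σ (from (σ̂ i))))      ≡⟨ sum-cong-≗ (λ i → cong h (σ-from-σ̂ i)) ⟩
    sum (λ i → h (from i))              ≡⟨ sym (∑-elements≡sum h) ⟩
    ∑[ a ∈ elements ] h a               ∎
    where
    open ≡-Reasoning
    σ̂ : Fin q → Fin q
    σ̂ = to ∘ σ ∘ from
    σ-from-σ̂ : ∀ i → σ (from (σ̂ i)) ≡ from i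
    σ-from-σ̂ i = trans (cong σ (Inverse.strictlyInverseʳ enum (σ (from i)))) (σσ≡id (from i))
    σ̂σ̂≡id : ∀ i → σ̂ (σ̂ i) ≡ i
    σ̂σ̂≡id i = begin
      to (σ (from (to (σ (from i)))))  ≡⟨ cong (to ∘ σ) (Inverse.strictlyInverseʳ enum _) ⟩
      to (σ (σ (from i)))              ≡⟨ cong to (σσ≡id (from i)) ⟩
      to (from i)                      ≡⟨ Inverse.strictlyInverseˡ enum i ⟩
      i                                ∎
    π : Permutation q q
    π = permutation σ̂ σ̂ σ̂σ̂≡id σ̂σ̂≡id

  ∑-allWords-suc : ∀ k (h : Word (suc k) → ℚ) →
    ∑∈ (allWords (suc k)) h ≡ ∑[ a ∈ elements ] ∑[ w ∈ allWords k ] h (a Vector.∷ w)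
  ∑-allWords-suc k h = trans (∑∈-concatMap _ elements h) (∑∈-cong elements (λ a → ∑∈-map _ (allWords k) h))

  ∑-allWords-negate : ∀ k (h : Word k → ℚ) → (∀ {m m′} → (∀ i → m i ≡ m′ i) → h m ≡ h m′) →
    ∑[ m ∈ allWords k ] h (negate m) ≡ ∑∈ (allWords k) h
  ∑-allWords-negate zero    h h-cong = cong (_+ 0ℚ) (h-cong (λ ()))
  ∑-allWords-negate (suc k) h h-cong = begin
    ∑[ m ∈ allWords (suc k) ] h (negate m)
      ≡⟨ ∑-allWords-suc k (h ∘ negate) ⟩
    ∑[ a ∈ elements ] ∑[ w ∈ allWords k ] h (negate (a Vector.∷ w))
      ≡⟨ ∑∈-cong elements (λ a → ∑∈-cong (allWords k) (λ w → h-cong λ { zero → refl ; (suc i) → refl })) ⟩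
    ∑[ a ∈ elements ] ∑[ w ∈ allWords k ] h ((-F a) Vector.∷ negate w)
      ≡⟨ ∑∈-cong elements (λ a → ∑-allWords-negate k (λ w → h ((-F a) Vector.∷ w))
                                   (λ w≗w′ → h-cong λ { zero → refl ; (suc i) → w≗w′ i })) ⟩
    ∑[ a ∈ elements ] ∑[ w ∈ allWords k ] h ((-F a) Vector.∷ w)
      ≡⟨ ∑-elements-involution -F_ -‿involutive (λ a → ∑[ w ∈ allWords k ] h (a Vector.∷ w)) ⟩
    ∑[ a ∈ elements ] ∑[ w ∈ allWords k ] h (a Vector.∷ w)
      ≡⟨ sym (∑-allWords-suc k h) ⟩
    ∑∈ (allWords (suc k)) h ∎
    where open ≡-Reasoning

  _[_]≔_ : ∀ {n} → Word n → Fin n → Carrier → Word n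
  v [ p ]≔ b = Vector.updateAt v p (const b)

  dist-[]≔ : ∀ {n} (v c : Word n) p b →
    dist (v [ p ]≔ b) c ℕ.+ indicator≢ (v p) (c p) ≡ indicator≢ b (c p) ℕ.+ dist v c
  dist-[]≔ {suc n} v c zero b = begin
    (x ℕ.+ d) ℕ.+ y  ≡⟨ ℕₚ.+-assoc x d y ⟩
    x ℕ.+ (d ℕ.+ y)  ≡⟨ cong (x ℕ.+_) (ℕₚ.+-comm d y) ⟩
    x ℕ.+ (y ℕ.+ d)  ∎
    where
    open ≡-Reasoning
    x y d : ℕ
    x = indicator≢ b (c zero)
    y = indicator≢ (v zero) (c zero)
    d = dist (λ i → v (suc i)) (λ i → c (suc i))
  dist-[]≔ {suc n} v c (suc p) b = begin
    (y ℕ.+ d′) ℕ.+ z  ≡⟨ ℕₚ.+-assoc y d′ z ⟩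
    y ℕ.+ (d′ ℕ.+ z)  ≡⟨ cong (y ℕ.+_) (dist-[]≔ (λ i → v (suc i)) (λ i → c (suc i)) p b) ⟩
    y ℕ.+ (x ℕ.+ d)   ≡⟨ ℕₚ.+-comm y (x ℕ.+ d) ⟩
    (x ℕ.+ d) ℕ.+ y   ≡⟨ ℕₚ.+-assoc x d y ⟩
    x ℕ.+ (d ℕ.+ y)   ≡⟨ cong (x ℕ.+_) (ℕₚ.+-comm d y) ⟩
    x ℕ.+ (y ℕ.+ d)   ∎
    where
    open ≡-Reasoning
    x y z d d′ : ℕ
    x = indicator≢ b (c (suc p))
    y = indicator≢ (v zero) (c zero)
    z = indicator≢ (v (suc p)) (c (suc p))
    d = dist (λ i → v (suc i)) (λ i → c (suc i))
    d′ = dist ((λ i → v (suc i)) [ p ]≔ b) (λ i → c (suc i))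

  ∑≠ : Carrier → (Carrier → ℚ) → ℚ
  ∑≠ a h = ∑[ b ∈ elements ] (if does (b ≟ a) then 0ℚ else h b)

  ∑-elements-at : ∀ a x → ∑[ b ∈ elements ] (if does (b ≟ a) then x else 0ℚ) ≡ x
  ∑-elements-at a x = trans (∑-elements-single _ a off-a) at-a
    where
    off-a : ∀ b → b ≢ a → (if does (b ≟ a) then x else 0ℚ) ≡ 0ℚ
    off-a b b≢a with b ≟ a
    ... | yes b≡a = ⊥-elim (b≢a b≡a)
    ... | no  _   = refl
    at-a : (if does (a ≟ a) then x else 0ℚ) ≡ x
    at-a with a ≟ a
    ... | yes _   = refl
    ... | no  a≢a = ⊥-elim (a≢a refl)

  ∑≠≡∑-minus : ∀ a (h : Carrier → ℚ) → ∑≠ a h ≡ ∑[ b ∈ elements ] h b - h a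
  ∑≠≡∑-minus a h = begin
    ∑≠ a h              ≡⟨ solve 2 (λ s x → s := (x :+ s) :- x) refl (∑≠ a h) (h a) ⟩
    h a + ∑≠ a h - h a  ≡⟨ cong (λ x → x + ∑≠ a h - h a) (sym (∑-elements-at a (h a))) ⟩
    ∑[ b ∈ elements ] (if does (b ≟ a) then h a else 0ℚ) + ∑≠ a h - h a
                        ≡⟨ cong (_- h a) (sym (∑∈-distrib-+ elements _ _)) ⟩
    ∑[ b ∈ elements ] ((if does (b ≟ a) then h a else 0ℚ) + (if does (b ≟ a) then 0ℚ else h b)) - h a
                        ≡⟨ cong (_- h a) (∑∈-cong elements (λ b → sym (split b))) ⟩
    ∑[ b ∈ elements ] h b - h a ∎
    where
    open ≡-Reasoning
    split : ∀ b → h b ≡ (if does (b ≟ a) then h a else 0ℚ) + (if does (b ≟ a) then 0ℚ else h b)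
    split b with b ≟ a
    ... | yes refl = sym (ℚₚ.+-identityʳ (h b))
    ... | no  _    = sym (ℚₚ.+-identityˡ (h b))

  ∑-indicator≢ : ∀ (f : ℕ → ℚ) c → ∑[ b ∈ elements ] f (indicator≢ b c) ≡ f 0 + (q̂ - 1ℚ) · f 1
  ∑-indicator≢ f c = begin
    ∑[ b ∈ elements ] f (indicator≢ b c)
      ≡⟨ ∑∈-cong elements split ⟩
    ∑[ b ∈ elements ] ((if does (b ≟ c) then f 0 - f 1 else 0ℚ) + f 1)
      ≡⟨ ∑∈-distrib-+ elements _ (const (f 1)) ⟩
    ∑[ b ∈ elements ] (if does (b ≟ c) then f 0 - f 1 else 0ℚ) + ∑[ b ∈ elements ] f 1
      ≡⟨ cong₂ _+_ (∑-elements-at c (f 0 - f 1)) (∑-elements-const (f 1)) ⟩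
    f 0 - f 1 + q̂ · f 1
      ≡⟨ solve 3 (λ x y q → x :- y :+ q :* y := x :+ (q :- con 1ℚ) :* y) refl (f 0) (f 1) q̂ ⟩
    f 0 + (q̂ - 1ℚ) · f 1 ∎
    where
    open ≡-Reasoning
    split : ∀ b → f (indicator≢ b c) ≡ (if does (b ≟ c) then f 0 - f 1 else 0ℚ) + f 1
    split b with b ≟ c
    ... | yes _ = solve 2 (λ x y → x := x :- y :+ y) refl (f 0) (f 1)
    ... | no  _ = sym (ℚₚ.+-identityˡ (f 1))

  -- With e = d(v,c): changing a coordinate where v agrees with c always moves to distance e + 1;
  -- where v disagrees, one choice moves to e - 1 and the other q - 2 stay at e.
  matchTerm : (ℕ → ℚ) → ℕ → ℚ
  matchTerm γ e = (q̂ - 1ℚ) · γ (suc e)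

  mismatchTerm : (ℕ → ℚ) → ℕ → ℚ
  mismatchTerm γ e = γ (e ℕ.∸ 1) + (q̂ - 1ℚ) · γ e - γ e

  ∑≠-match : ∀ (γ : ℕ → ℚ) (D : Carrier → ℕ) a c e → a ≡ c →
    (∀ b → D b ≡ indicator≢ b c ℕ.+ e) → ∑≠ a (γ ∘ D) ≡ matchTerm γ e
  ∑≠-match γ D a c e a≡c D≡ = begin
    ∑≠ a (γ ∘ D)                                 ≡⟨ ∑≠≡∑-minus a (γ ∘ D) ⟩
    ∑[ b ∈ elements ] γ (D b) - γ (D a)          ≡⟨ cong₂ _-_ (∑∈-cong elements (cong γ ∘ D≡)) (cong γ Da≡e) ⟩
    ∑[ b ∈ elements ] γ (indicator≢ b c ℕ.+ e) - γ e
                                                 ≡⟨ cong (_- γ e) (∑-indicator≢ (λ i → γ (i ℕ.+ e)) c) ⟩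
    γ e + (q̂ - 1ℚ) · γ (suc e) - γ e             ≡⟨ solve 2 (λ x y → x :+ y :- x := y) refl (γ e) (matchTerm γ e) ⟩
    matchTerm γ e                                ∎
    where
    open ≡-Reasoning
    Da≡e : D a ≡ e
    Da≡e = trans (D≡ a) (cong (ℕ._+ e) (indicator≢-≡ a≡c))

  ∑≠-mismatch : ∀ (γ : ℕ → ℚ) (D : Carrier → ℕ) a c e → a ≢ c →
    (∀ b → D b ℕ.+ 1 ≡ indicator≢ b c ℕ.+ e) → ∑≠ a (γ ∘ D) ≡ mismatchTerm γ e
  ∑≠-mismatch γ D a c zero    a≢c D≡ =
    ⊥-elim (ℕₚ.1+n≢0 (trans (ℕₚ.+-comm 1 (D c)) (trans (D≡ c) (cong (ℕ._+ 0) (indicator≢-≡ refl)))))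
  ∑≠-mismatch γ D a c (suc e) a≢c D≡ = begin
    ∑≠ a (γ ∘ D)                                 ≡⟨ ∑≠≡∑-minus a (γ ∘ D) ⟩
    ∑[ b ∈ elements ] γ (D b) - γ (D a)          ≡⟨ cong₂ _-_ (∑∈-cong elements (cong γ ∘ D≡′)) (cong γ Da≡1+e) ⟩
    ∑[ b ∈ elements ] γ (indicator≢ b c ℕ.+ e) - γ (suc e)
                                                 ≡⟨ cong (_- γ (suc e)) (∑-indicator≢ (λ i → γ (i ℕ.+ e)) c) ⟩
    mismatchTerm γ (suc e)                       ∎
    where
    open ≡-Reasoning
    D≡′ : ∀ b → D b ≡ indicator≢ b c ℕ.+ e
    D≡′ b = ℕₚ.suc-injective (trans (ℕₚ.+-comm 1 (D b)) (trans (D≡ b) (ℕₚ.+-suc (indicator≢ b c) e)))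
    Da≡1+e : D a ≡ suc e
    Da≡1+e = trans (D≡′ a) (cong (ℕ._+ e) (indicator≢-≢ a≢c))

  ∑≠-position : ∀ (γ : ℕ → ℚ) (D : Carrier → ℕ) a c e →
    (∀ b → D b ℕ.+ indicator≢ a c ≡ indicator≢ b c ℕ.+ e) →
    ∑≠ a (γ ∘ D) ≡ toℚ (indicator≢ a c) · mismatchTerm γ e + (1ℚ - toℚ (indicator≢ a c)) · matchTerm γ e
  ∑≠-position γ D a c e D≡ = by-cases (a ≟ c)
    where
    open ≡-Reasoning
    M Y : ℚ
    M = mismatchTerm γ e
    Y = matchTerm γ e
    weighted : ℕ → ℚ
    weighted i = toℚ i · M + (1ℚ - toℚ i) · Y
    by-cases : Dec (a ≡ c) → ∑≠ a (γ ∘ D) ≡ weighted (indicator≢ a c)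
    by-cases (yes a≡c) = begin
      ∑≠ a (γ ∘ D)  ≡⟨ ∑≠-match γ D a c e a≡c (λ b → trans (sym (ℕₚ.+-identityʳ (D b)))
                                                 (trans (cong (D b ℕ.+_) (sym (indicator≢-≡ a≡c))) (D≡ b))) ⟩
      Y             ≡⟨ solve 2 (λ m y → y := con 0ℚ :* m :+ (con 1ℚ :- con 0ℚ) :* y) refl M Y ⟩
      weighted 0    ≡⟨ cong weighted (sym (indicator≢-≡ a≡c)) ⟩
      weighted (indicator≢ a c) ∎
    by-cases (no a≢c) = begin
      ∑≠ a (γ ∘ D)  ≡⟨ ∑≠-mismatch γ D a c e a≢c (λ b → trans (cong (D b ℕ.+_) (sym (indicator≢-≢ a≢c))) (D≡ b)) ⟩
      M             ≡⟨ solve 2 (λ m y → m := con 1ℚ :* m :+ (con 1ℚ :- con 1ℚ) :* y) refl M Y ⟩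
      weighted 1    ≡⟨ cong weighted (sym (indicator≢-≢ a≢c)) ⟩
      weighted (indicator≢ a c) ∎

  T : ℕ → (ℕ → ℚ) → ℕ → ℚ
  T n γ e = toℚ e · mismatchTerm γ e + (toℚ n - toℚ e) · matchTerm γ e

  T-vanishes : ∀ n (γ : ℕ → ℚ) L → (∀ j → L < j → γ j ≡ 0ℚ) → ∀ j → suc L < j → T n γ j ≡ 0ℚ
  T-vanishes n γ L γ≡0 (suc (suc j)) (s≤s (s≤s L<1+j))
    rewrite γ≡0 (suc j) (s≤s L<1+j)
          | γ≡0 (suc (suc j)) (ℕₚ.m<n⇒m<1+n (s≤s L<1+j))
          | γ≡0 (suc (suc (suc j))) (ℕₚ.m<n⇒m<1+n (ℕₚ.m<n⇒m<1+n (s≤s L<1+j))) =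
    solve 3 (λ e n q → e :* (con 0ℚ :+ (q :- con 1ℚ) :* con 0ℚ :- con 0ℚ) :+ (n :- e) :* ((q :- con 1ℚ) :* con 0ℚ)
                     := con 0ℚ)
      refl (toℚ (suc (suc j))) (toℚ n) q̂

  T-leading : ∀ n (γ : ℕ → ℚ) L → (∀ j → L < j → γ j ≡ 0ℚ) → T n γ (suc L) ≡ toℚ (suc L) · γ L
  T-leading n γ L γ≡0
    rewrite γ≡0 (suc L) ℕₚ.≤-refl
          | γ≡0 (suc (suc L)) (ℕₚ.m<n⇒m<1+n ℕₚ.≤-refl) =
    solve 4 (λ e n q g → e :* (g :+ (q :- con 1ℚ) :* con 0ℚ :- con 0ℚ) :+ (n :- e) :* ((q :- con 1ℚ) :* con 0ℚ)
                       := e :* g)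
      refl (toℚ (suc L)) (toℚ n) q̂ (γ L)

  neighbourSum : ∀ {n} → (Word n → ℚ) → Word n → ℚ
  neighbourSum H v = sum (λ p → ∑≠ (v p) (λ b → H (v [ p ]≔ b)))

  neighbourSum-cong : ∀ {n} {H H′ : Word n → ℚ} → (∀ w → H w ≡ H′ w) →
    ∀ v → neighbourSum H v ≡ neighbourSum H′ v
  neighbourSum-cong H≗H′ v = sum-cong-≗ (λ p → ∑∈-cong elements (λ b →
    cong (λ x → if does (b ≟ v p) then 0ℚ else x) (H≗H′ (v [ p ]≔ b))))

  neighbourSum-const : ∀ {n} κ (v : Word n) → neighbourSum (const κ) v ≡ toℚ n · (q̂ · κ - κ)
  neighbourSum-const {n} κ v = begin
    sum (λ p → ∑≠ (v p) (const κ))  ≡⟨ sum-cong-≗ (λ p → trans (∑≠≡∑-minus (v p) (const κ))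
                                                             (cong (_- κ) (∑-elements-const κ))) ⟩
    sum {n} (const (q̂ · κ - κ))    ≡⟨ sum-const n (q̂ · κ - κ) ⟩
    toℚ n · (q̂ · κ - κ)             ∎
    where open ≡-Reasoning

  neighbourSum-∑∈ : ∀ {A : Set} {n} (xs : List A) (H : A → Word n → ℚ) v →
    neighbourSum (λ w → ∑[ x ∈ xs ] H x w) v ≡ ∑[ x ∈ xs ] neighbourSum (H x) v
  neighbourSum-∑∈ xs H v =
    trans (sum-cong-≗ (λ p → trans (∑∈-cong elements (skip-∑∈ p)) (∑∈-comm elements xs _)))
          (sum-∑∈-comm xs (λ p x → ∑≠ (v p) (λ b → H x (v [ p ]≔ b))))
    where
    skip-∑∈ : ∀ p b → (if does (b ≟ v p) then 0ℚ else ∑[ x ∈ xs ] H x (v [ p ]≔ b))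
                    ≡ ∑[ x ∈ xs ] (if does (b ≟ v p) then 0ℚ else H x (v [ p ]≔ b))
    skip-∑∈ p b with b ≟ v p
    ... | yes _ = sym (∑∈-zero xs)
    ... | no  _ = refl

  neighbourSum-dist : ∀ {n} (γ : ℕ → ℚ) (v c : Word n) →
    neighbourSum (λ w → γ (dist w c)) v ≡ T n γ (dist v c)
  neighbourSum-dist γ v c = trans
    (sum-cong-≗ (λ p → ∑≠-position γ (λ b → dist (v [ p ]≔ b) c) (v p) (c p) (dist v c) (dist-[]≔ v c p)))
    (sum-affine (λ p → indicator≢ (v p) (c p)) (mismatchTerm γ (dist v c)) (matchTerm γ (dist v c)))

  module _ {k n : ℕ} (G : Fin k → Word n) where

    distanceSum : (ℕ → ℚ) → Word n → ℚ
    distanceSum γ v = ∑[ m ∈ allWords k ] γ (dist v (encode G m))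

    distanceSum≡∑<B : ∀ L (γ : ℕ → ℚ) → (∀ j → L < j → γ j ≡ 0ℚ) → ∀ v →
      distanceSum γ v ≡ ∑[ j < suc L ] (γ j · toℚ (B G j v))
    distanceSum≡∑<B L γ γ≡0 v = ∑∈-regroup (suc L) γ γ≡0 (allWords k) (λ m → dist v (encode G m))

    neighbourSum-distanceSum : ∀ (γ : ℕ → ℚ) v → neighbourSum (distanceSum γ) v ≡ distanceSum (T n γ) v
    neighbourSum-distanceSum γ v =
      trans (neighbourSum-∑∈ (allWords k) (λ m w → γ (dist w (encode G m))) v)
            (∑∈-cong (allWords k) (λ m → neighbourSum-dist γ v (encode G m)))

    record LinearRelation (L : ℕ) : Set where
      field
        coeff     : ℕ → ℚ
        vanishes  : ∀ j → L < j → coeff j ≡ 0ℚ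
        leading≢0 : coeff L ≢ 0ℚ
        value     : ℚ
        holds     : ∀ v → distanceSum coeff v ≡ value

    LinearRelation-suc : ∀ {L} → LinearRelation L → LinearRelation (suc L)
    LinearRelation-suc {L} r = record
      { coeff     = T n coeff
      ; vanishes  = T-vanishes n coeff L vanishes
      ; leading≢0 = λ eq → *-≢0 (toℚ-suc≢0 L) leading≢0 (trans (sym (T-leading n coeff L vanishes)) eq)
      ; value     = toℚ n · (q̂ · value - value)
      ; holds     = λ v → begin
          distanceSum (T n coeff) v           ≡⟨ sym (neighbourSum-distanceSum coeff v) ⟩
          neighbourSum (distanceSum coeff) v  ≡⟨ neighbourSum-cong holds v ⟩
          neighbourSum (const value) v        ≡⟨ neighbourSum-const value v ⟩
          toℚ n · (q̂ · value - value)         ∎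
      }
      where
      open LinearRelation r
      open ≡-Reasoning

    LinearRelation-+ : ∀ {L} t → LinearRelation L → LinearRelation (t ℕ.+ L)
    LinearRelation-+ zero    r = r
    LinearRelation-+ (suc t) r = LinearRelation-suc (LinearRelation-+ t r)

    B-leading-agree : ∀ {L} → LinearRelation L → ∀ u u′ →
      (∀ i → i < L → B G i u ≡ B G i u′) → B G L u ≡ B G L u′
    B-leading-agree {L} r u u′ agree =
      toℚ-injective (*-cancelˡ-≢0 (coeff L) leading≢0 (+-cancelˡ (lower u) (begin
        lower u + coeff L · toℚ (B G L u)   ≡⟨ sym (distanceSum≡∑<B L coeff vanishes u) ⟩
        distanceSum coeff u                 ≡⟨ trans (holds u) (sym (holds u′)) ⟩
        distanceSum coeff u′                ≡⟨ distanceSum≡∑<B L coeff vanishes u′ ⟩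
        lower u′ + coeff L · toℚ (B G L u′) ≡⟨ cong (_+ coeff L · toℚ (B G L u′)) (sym lower-agree) ⟩
        lower u + coeff L · toℚ (B G L u′)  ∎)))
      where
      open LinearRelation r
      open ≡-Reasoning
      lower : Word n → ℚ
      lower w = ∑[ j < L ] (coeff j · toℚ (B G j w))
      lower-agree : lower u ≡ lower u′
      lower-agree = ∑<-cong L (λ j j<L → cong (λ b → coeff j · toℚ b) (agree j j<L))

    B-below-distance : ∀ {v r} → DistToCode G v r → ∀ j → j < r → B G j v ≡ 0
    B-below-distance {v} {r} (_ , r≤dist) j j<r = count-≡0 (allWords k) (λ m → dist v (encode G m)) j
      (λ m dist≡j → ℕₚ.<⇒≱ j<r (subst (r ≤_) dist≡j (r≤dist (encode G m) (m , λ _ → refl))))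

    B-agree : ∀ {R} → LinearRelation R → ∀ {u u′} → DistToCode G u R → DistToCode G u′ R →
      ∀ i → B G i u ≡ B G i u′
    B-agree {R} r {u} {u′} u-R u′-R i = agree-below (suc i) i (ℕₚ.m≤m+n (suc i) R)
      where
      agree-below : ∀ t i → i < t ℕ.+ R → B G i u ≡ B G i u′
      agree-below zero    i i<R = trans (B-below-distance u-R i i<R) (sym (B-below-distance u′-R i i<R))
      agree-below (suc t) i i<1+t+R with ℕₚ.m≤n⇒m<n∨m≡n (ℕₚ.≤-pred i<1+t+R)
      ... | inj₁ i<t+R = agree-below t i i<t+R
      ... | inj₂ refl  = B-leading-agree (LinearRelation-+ t r) u u′ (agree-below t)

    UPWS⇒LinearRelation : ∀ {R} → UPWS G R → (∃ λ v → DistToCode G v R) → LinearRelation R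
    UPWS⇒LinearRelation {R} (β , β-identity) (v₀ , v₀-R) = record
      { coeff     = β′
      ; vanishes  = zeroExtend-vanishes β
      ; leading≢0 = β′R≢0
      ; value     = 1ℚ
      ; holds     = holds
      }
      where
      open ≡-Reasoning
      β′ : ℕ → ℚ
      β′ = zeroExtend β
      expand : ∀ v → distanceSum β′ v ≡ ∑[ j < suc R ] (β′ j · toℚ (B G j v))
      expand = distanceSum≡∑<B R β′ (zeroExtend-vanishes β)
      holds : ∀ v → distanceSum β′ v ≡ 1ℚ
      holds v = trans (expand v)
        (trans (sym (sum≡∑<-zeroExtend (suc R) β (λ j → toℚ (B G j v)))) (β-identity v))
      β′R≢0 : β′ R ≢ 0ℚ
      β′R≢0 β′R≡0 = ℚₚ.1≢0 (begin
        1ℚ                      ≡⟨ sym (holds v₀) ⟩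
        distanceSum β′ v₀       ≡⟨ expand v₀ ⟩
        ∑[ j < R ] (β′ j · toℚ (B G j v₀)) + β′ R · toℚ (B G R v₀)
                                ≡⟨ cong₂ _+_ (∑<-zero R _ lower≡0)
                                             (trans (cong (_· toℚ (B G R v₀)) β′R≡0) (ℚₚ.*-zeroˡ (toℚ (B G R v₀)))) ⟩
        0ℚ + 0ℚ                 ≡⟨ ℚₚ.+-identityˡ 0ℚ ⟩
        0ℚ                      ∎)
        where
        lower≡0 : ∀ j → j < R → β′ j · toℚ (B G j v₀) ≡ 0ℚ
        lower≡0 j j<R = trans (cong (λ b → β′ j · toℚ b) (B-below-distance v₀-R j j<R)) (ℚₚ.*-zeroʳ (β′ j))

    cosetWD≡B : ∀ u i → cosetWD G u i ≡ B G i u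
    cosetWD≡B u i = toℚ-injective (begin
      toℚ (cosetWD G u i)                             ≡⟨ toℚ-count (allWords k) (λ m → wt (u ⊕ encode G m)) i ⟩
      ∑[ m ∈ allWords k ] δ (wt (u ⊕ encode G m)) i   ≡⟨ ∑∈-cong (allWords k) (λ m → cong (λ d → δ d i) (wt≡dist m)) ⟩
      ∑[ m ∈ allWords k ] δ-dist (negate m)           ≡⟨ ∑-allWords-negate k δ-dist δ-dist-cong ⟩
      ∑[ m ∈ allWords k ] δ-dist m                    ≡⟨ sym (toℚ-count (allWords k) (λ m → dist u (encode G m)) i) ⟩
      toℚ (B G i u)                                   ∎)
      where
      open ≡-Reasoning
      δ-dist : Word k → ℚ
      δ-dist m = δ (dist u (encode G m)) i
      δ-dist-cong : ∀ {m m′} → (∀ j → m j ≡ m′ j) → δ-dist m ≡ δ-dist m′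
      δ-dist-cong m≗m′ = cong (λ d → δ d i) (dist-cong (λ _ → refl) (encode-cong G m≗m′))
      wt≡dist : ∀ m → wt (u ⊕ encode G m) ≡ dist u (encode G (negate m))
      wt≡dist m = trans (wt-⊕ u (encode G m)) (dist-cong (λ _ → refl) (λ j → sym (encode-negate G m j)))

    CosetWeight⇒DistToCode : ∀ {u w} → CosetWeight G u w → DistToCode G u w
    CosetWeight⇒DistToCode {u} {w} ((c , c∈C , wt≡w) , w≤wt) =
      (negate c , negate-∈C c∈C , trans (sym (wt-⊕ u c)) wt≡w) ,
      λ c′ c′∈C → subst (w ≤_) (wt≡dist c′) (w≤wt (negate c′) (negate-∈C c′∈C))
      where
      wt≡dist : ∀ c′ → wt (u ⊕ negate c′) ≡ dist u c′
      wt≡dist c′ = trans (wt-⊕ u (negate c′)) (dist-cong (λ _ → refl) (λ j → -‿involutive (c′ j)))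

theorem5p2 : {q : ℕ} (F : FiniteField q) → let open Code F in
    (n k d R : ℕ) (G : Fin k → Word n) →
    IsCode n k d R G →
    UPWS G R →
      (∀ (u u′ : Word n) → CosetWeight G u R → CosetWeight G u′ R →
         ∀ (i : ℕ) → cosetWD G u i ≡ cosetWD G u′ i)
      × (∀ (u : Word n) → CosetWeight G u R → APMCF G R (cosetWD G u R))
      × (2 * R ≤ d → ∀ (u : Word n) → CosetWeight G u R →
           PMCF G d R (cosetWD G u R))
theorem5p2 F n k d R G isCode upws = same-distribution , apmcf , λ 2R≤d u u-R → 2R≤d , apmcf u u-R
  where
  open Code F hiding (toℚ)
  open CodeProperties F
  open ≡-Reasoning

  relation : LinearRelation G R
  relation = UPWS⇒LinearRelation G upws (IsCode.radius-attained isCode)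

  same-distribution : ∀ u u′ → CosetWeight G u R → CosetWeight G u′ R → ∀ i → cosetWD G u i ≡ cosetWD G u′ i
  same-distribution u u′ u-R u′-R i = begin
    cosetWD G u i   ≡⟨ cosetWD≡B G u i ⟩
    B G i u         ≡⟨ B-agree G relation (CosetWeight⇒DistToCode G u-R) (CosetWeight⇒DistToCode G u′-R) i ⟩
    B G i u′        ≡⟨ sym (cosetWD≡B G u′ i) ⟩
    cosetWD G u′ i  ∎

  apmcf : ∀ u → CosetWeight G u R → APMCF G R (cosetWD G u R)
  apmcf u u-R v v-R = trans (B-agree G relation v-R (CosetWeight⇒DistToCode G u-R) R) (sym (cosetWD≡B G u R))
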